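{- Fix an integer $k\geq -1$. For all integers $g\geq 4k+3$, \[ \#\{S\in\mathcal{S}_g\mid m(S)=g-k\}=\sum_{\overline{x}\in\mathcal{Y}(k)}\binom{g-3k-2}{k+1-a(\overline{x})-2b(\overline{x})}. \]
   Context: A numerical semigroup $S$ is a submonoid of $\mathbb{N}_0$ with finite complement; its genus is $|\mathbb{N}_0\setminus S|$ and its multiplicity $m(S)$ is its smallest nonzero element. $\mathcal{S}_g$ is the finite set of numerical semigroups of genus $g$. For $\overline{x}=(x_1,\ldots,x_t)\in\{1,2,3\}^t$ let $a(\overline{x})=\#\{i\in[1,t]\mid x_i=2\}$ and $b(\overline{x})=\#\{i\in[1,t]\mid x_i=3\}$. For $k\ge -1$, $\mathcal{Y}(k)$ is the set of tuples $\overline{x}=(x_1,\ldots,x_{2k+1})\in\{1,2,3\}^{2k+1}$ (so $\mathcal{Y}(-1)$ consists of the empty tuple) such that (i) whenever $i_1,i_2,i_3\in[1,2k+1]$ with $i_1+i_2=i_3$ we have $(x_{i_1},x_{i_2},x_{i_3})\neq(1,1,3)$, and (ii) $a(\overline{x})+2b(\overline{x})\le k+1$. -}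

module Defs where

open import Data.Nat using (ℕ; zero; suc; _+_; _*_; _∸_; _≤_; _<_)
open import Data.Nat.Properties using (_≟_; _≤?_)
open import Data.Fin using (Fin; toℕ)
open import Data.Fin.Properties using (all?)
open import Data.Vec using (Vec; []; _∷_; lookup; count)
open import Data.List using (List; []; _∷_; length; map; concatMap; filter)
open import Data.Nat.ListAction using (sum)
open import Data.List.Membership.Propositional using (_∈_; _∉_)
open import Data.List.Relation.Unary.Linked using (Linked)
open import Data.List.Relation.Unary.Unique.Propositional using (Unique)
open import Data.Product using (Σ; _×_; _,_)
open import Function.Bundles using (_⇔_)
open import Relation.Binary.PropositionalEquality using (_≡_; refl)
open import Relation.Nullary using (¬_; Dec; yes; no)
open import Relation.Nullary.Decidable using (_×-dec_; ¬?; _→-dec_)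
open import Data.Nat.Combinatorics using (_C_)

HasCardinality : (A : Set) → (A → Set) → ℕ → Set
HasCardinality A P n =
  Σ (List A) λ L → Unique L × (∀ x → (x ∈ L) ⇔ P x) × length L ≡ n

-- A numerical semigroup S ⊆ ℕ₀ has finite
-- complement, so it is determined by its gap set ℕ₀ ∖ S, which we store
-- canonically as a strictly increasing list G.  Then S = { n | n ∉ G }.

record IsNumericalSemigroup (G : List ℕ) : Set where
  field
    canonical : Linked _<_ G
    zero∈S    : 0 ∉ G
    closed    : ∀ x y → x ∉ G → y ∉ G → (x + y) ∉ G

_∈S_ : ℕ → List ℕ → Set
n ∈S G = n ∉ G

genus : List ℕ → ℕ
genus G = length G

IsMultiplicity : List ℕ → ℕ → Set
IsMultiplicity G m = 0 < m × m ∈S G × (∀ n → 0 < n → n < m → ¬ (n ∈S G))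

InSgWithMult : ℕ → ℕ → List ℕ → Set
InSgWithMult g m G = IsNumericalSemigroup G × genus G ≡ g × IsMultiplicity G m

data Digit : Set where
  one two three : Digit

_≟D_ : (x y : Digit) → Dec (x ≡ y)
one   ≟D one   = yes refl
one   ≟D two   = no λ ()
one   ≟D three = no λ ()
two   ≟D one   = no λ ()
two   ≟D two   = yes refl
two   ≟D three = no λ ()
three ≟D one   = no λ ()
three ≟D two   = no λ ()
three ≟D three = yes refl

tuples : (t : ℕ) → List (Vec Digit t)
tuples zero    = [] ∷ []
tuples (suc t) = concatMap (λ v → (one ∷ v) ∷ (two ∷ v) ∷ (three ∷ v) ∷ []) (tuples t)

a : ∀ {t} → Vec Digit t → ℕ
a = count (_≟D two)

b : ∀ {t} → Vec Digit t → ℕ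
b = count (_≟D three)

-- Condition (i): positions are 1-based, position of i : Fin t is toℕ i + 1.
CondI : ∀ {t} → Vec Digit t → Set
CondI {t} x = (i₁ i₂ i₃ : Fin t) →
  (toℕ i₁ + 1) + (toℕ i₂ + 1) ≡ toℕ i₃ + 1 →
  ¬ (lookup x i₁ ≡ one × lookup x i₂ ≡ one × lookup x i₃ ≡ three)

-- Membership in 𝒴(k), where the parameter k1 = k + 1 (so k ≥ -1 ↔ k1 : ℕ)
-- and tuples have length 2k+1 = 2*k1 ∸ 1 (the empty tuple when k = -1).
InY : (k1 : ℕ) → Vec Digit (2 * k1 ∸ 1) → Set
InY k1 x = CondI x × a x + 2 * b x ≤ k1

condI? : ∀ {t} (x : Vec Digit t) → Dec (CondI x)
condI? x = all? λ i₁ → all? λ i₂ → all? λ i₃ →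
  ((toℕ i₁ + 1) + (toℕ i₂ + 1) ≟ toℕ i₃ + 1) →-dec
  ¬? ((lookup x i₁ ≟D one) ×-dec ((lookup x i₂ ≟D one) ×-dec (lookup x i₃ ≟D three)))

inY? : (k1 : ℕ) (x : Vec Digit (2 * k1 ∸ 1)) → Dec (InY k1 x)
inY? k1 x = condI? x ×-dec (a x + 2 * b x ≤? k1)

Y : (k1 : ℕ) → List (Vec Digit (2 * k1 ∸ 1))
Y k1 = filter (inY? k1) (tuples (2 * k1 ∸ 1))

-- Right-hand side:  Σ_{x ∈ 𝒴(k)} C(g-3k-2, k+1-a(x)-2b(x)),
-- with k = k1 - 1:  g-3k-2 = g+1-3k1,  k+1-a-2b = k1-(a+2b)
-- (both nonnegative under g ≥ 4k+3 and condition (ii)).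
rhs : (k1 g : ℕ) → ℕ
rhs k1 g = sum (map (λ x → (g + 1 ∸ 3 * k1) C (k1 ∸ (a x + 2 * b x))) (Y k1))

-- Write m = g - k for the multiplicity and L = m - 1. A semigroup S counted here is encoded by a
-- word w ∈ {1,2,3}^L: its gaps are 1, …, L, then m + 1 + j when w_j ≠ 1, and 2m + 1 + j when
-- w_j = 3 (there are no others). Closure under addition says exactly that w_p = w_q = 1 never
-- occurs with w_(p+q+1) = 3, and the genus is L + a(w) + 2b(w), so a(w) + 2b(w) = k + 1.
-- Conversely, if 2m + 1 + j is a gap, the pairs (m + 1 + i, 2m + 1 + j − (m + 1 + i)) each
-- contain a gap, and counting them against the genus bounds j by 2k; so every 3 lies among the
-- first 2k + 1 digits. Hence w is a tuple x ∈ 𝒴(k) followed by a word in {1,2}^(L − 2k − 1) with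
-- k + 1 − a(x) − 2b(x) twos. Only 3(k + 1) ≤ g + 1, i.e. L ≥ 2k + 1, is needed.
module Submission where

open import Defs
open import Data.Nat using (ℕ; zero; suc; _+_; _*_; _∸_; _≤_; _≰_; _<_; z≤n; s≤s; s≤s⁻¹)
open import Data.Nat.Properties
open import Data.Nat.Combinatorics using (_C_; nCk+nC[k+1]≡[n+1]C[k+1])
open import Data.Nat.ListAction using (sum)
open import Data.Nat.Tactic.RingSolver using (solve-∀)
open import Data.Bool using (true; false; if_then_else_)
open import Data.Fin using (Fin; toℕ; fromℕ<) renaming (zero to fzero; suc to fsuc)
open import Data.Fin.Properties using (toℕ<n; toℕ-fromℕ<)
open import Data.Vec using (Vec; []; _∷_; lookup; count; splitAt; tail) renaming (_++_ to _++ᵛ_)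
import Data.Vec.Properties as Vec
open import Data.List using (List; []; _∷_; length; map; concatMap; filter; _++_; applyUpTo)
open import Data.List.Properties using (length-++; length-map; length-applyUpTo; filter-++; applyUpTo-∷ʳ; map-cong)
open import Data.List.Membership.Propositional using (_∈_; _∉_; find; lose)
open import Data.List.Membership.Propositional.Properties
  using (∈-∃++; ∈-++⁻; ∈-++⁺ˡ; ∈-++⁺ʳ; ∈-map⁺; ∈-map⁻; ∈-concatMap⁺; ∈-concatMap⁻;
         ∈-applyUpTo⁺; ∈-applyUpTo⁻; ∈-filter⁺; ∈-filter⁻)
open import Data.List.Membership.DecPropositional _≟_ using (_∈?_)
open import Data.List.Relation.Binary.Subset.Propositional using (_⊆_)
open import Data.List.Relation.Unary.Any using (here; there)
import Data.List.Relation.Unary.All as All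
open All using ([]; _∷_)
open import Data.List.Relation.Unary.AllPairs as AllPairs using (AllPairs; []; _∷_)
import Data.List.Relation.Unary.AllPairs.Properties as AllPairs
open import Data.List.Relation.Unary.Linked.Properties using (AllPairs⇒Linked; Linked⇒AllPairs)
open import Data.List.Relation.Unary.Unique.Propositional using (Unique)
import Data.List.Relation.Unary.Unique.Propositional.Properties as Unique
open import Data.Product using (∃-syntax; _×_; _,_; proj₁; proj₂)
open import Data.Sum using (_⊎_; inj₁; inj₂; [_,_])
open import Data.Empty using (⊥; ⊥-elim)
open import Function using (_∘_; id; Injective)
open import Function.Bundles using (_⇔_; mk⇔; Equivalence)
import Function.Properties.Equivalence as ⇔
open import Level using (0ℓ)
open import Relation.Binary.PropositionalEquality
  using (_≡_; _≢_; refl; sym; trans; cong; cong₂; subst; subst₂; module ≡-Reasoning)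
open import Relation.Nullary using (¬_; Dec; yes; no; does; ¬?; contradiction)
open import Relation.Nullary.Decidable using (decidable-stable)
open import Relation.Unary using (Pred; Decidable)

strictlySorted-≡ : {xs ys : List ℕ} → AllPairs _<_ xs → AllPairs _<_ ys →
                   xs ⊆ ys → ys ⊆ xs → xs ≡ ys
strictlySorted-≡ {[]}     {[]}     _ _ _ _ = refl
strictlySorted-≡ {[]}     {y ∷ _}  _ _ _ ys⊆xs with () ← ys⊆xs (here refl)
strictlySorted-≡ {x ∷ _}  {[]}     _ _ xs⊆ys _ with () ← xs⊆ys (here refl)
strictlySorted-≡ {x ∷ xs} {y ∷ ys} (x<xs ∷ sxs) (y<ys ∷ sys) xs⊆ys ys⊆xs =
  cong₂ _∷_ x≡y (strictlySorted-≡ sxs sys (drop xs⊆ys x<xs x≡y) (drop ys⊆xs y<ys (sym x≡y)))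
  where
  x≡y : x ≡ y
  x≡y with xs⊆ys (here refl) | ys⊆xs (here refl)
  ... | here x≡y  | _         = x≡y
  ... | there _   | here y≡x  = sym y≡x
  ... | there y<x | there x<y = ⊥-elim (<-asym (All.lookup y<ys y<x) (All.lookup x<xs x<y))
  drop : ∀ {u v us vs} → u ∷ us ⊆ v ∷ vs → All.All (u <_) us → u ≡ v → us ⊆ vs
  drop us⊆vs u<us refl z∈us with us⊆vs (there z∈us)
  ... | here refl = ⊥-elim (<-irrefl refl (All.lookup u<us z∈us))
  ... | there z∈vs = z∈vs

Unique⇒length≤ : {A : Set} {xs ys : List A} → Unique xs → xs ⊆ ys → length xs ≤ length ys
Unique⇒length≤ {xs = []} _ _ = z≤n
Unique⇒length≤ {xs = x ∷ xs} (x∉xs ∷ uxs) xs⊆ys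
  with ys₁ , ys₂ , refl ← ∈-∃++ (xs⊆ys (here refl)) = begin
    suc (length xs)              ≤⟨ s≤s (Unique⇒length≤ uxs xs⊆ys₁++ys₂) ⟩
    suc (length (ys₁ ++ ys₂))    ≡⟨ cong suc (length-++ ys₁) ⟩
    suc (length ys₁ + length ys₂) ≡⟨ +-suc (length ys₁) (length ys₂) ⟨
    length ys₁ + length (x ∷ ys₂) ≡⟨ length-++ ys₁ ⟨
    length (ys₁ ++ x ∷ ys₂)      ∎
  where
  open ≤-Reasoning
  xs⊆ys₁++ys₂ : xs ⊆ ys₁ ++ ys₂
  xs⊆ys₁++ys₂ z∈xs with ∈-++⁻ ys₁ (xs⊆ys (there z∈xs))
  ... | inj₁ z∈ys₁         = ∈-++⁺ˡ z∈ys₁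
  ... | inj₂ (here refl)   = ⊥-elim (All.lookup x∉xs z∈xs refl)
  ... | inj₂ (there z∈ys₂) = ∈-++⁺ʳ ys₁ z∈ys₂

Unique-concatMap : {A B : Set} (f : A → List B) {xs : List A} → Unique xs →
  (∀ x → Unique (f x)) → (∀ {x x′ z} → z ∈ f x → z ∈ f x′ → x ≡ x′) →
  Unique (concatMap f xs)
Unique-concatMap f {[]}     _            _     _        = []
Unique-concatMap f {x ∷ xs} (x∉xs ∷ uxs) ufs   disjoint =
  Unique.++⁺ (ufs x) (Unique-concatMap f uxs ufs disjoint) λ (z∈fx , z∈rest) →
    let x′ , x′∈xs , z∈fx′ = find (∈-concatMap⁻ f {xs = xs} z∈rest)
    in All.lookup x∉xs x′∈xs (disjoint z∈fx z∈fx′)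

length-concatMap : {A B : Set} (f : A → List B) (xs : List A) →
                   length (concatMap f xs) ≡ sum (map (length ∘ f) xs)
length-concatMap f []       = refl
length-concatMap f (x ∷ xs) = trans (length-++ (f x)) (cong (length (f x) +_) (length-concatMap f xs))

HasCardinality-map : {A B : Set} {P : B → Set} (f : A → B) → Injective _≡_ _≡_ f →
  (xs : List A) → Unique xs → (∀ {x} → x ∈ xs → P (f x)) →
  (∀ {y} → P y → ∃[ x ] x ∈ xs × y ≡ f x) → HasCardinality B P (length xs)
HasCardinality-map {P = P} f f-inj xs uxs sound complete =
  map f xs , Unique.map⁺ f-inj uxs , (λ y → mk⇔ to from) , length-map f xs
  where
  to : ∀ {y} → y ∈ map f xs → P y
  to y∈ with x , x∈xs , refl ← ∈-map⁻ f y∈ = sound x∈xs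
  from : ∀ {y} → P y → y ∈ map f xs
  from Py with x , x∈xs , refl ← complete Py = ∈-map⁺ f x∈xs

module _ {P : Pred ℕ 0ℓ} (P? : Decidable P) where

  private
    #_ : List ℕ → ℕ
    # xs = length (filter P? xs)

  count-covering-pairs : ∀ (f h : ℕ → ℕ) J → (∀ i j → suc (i + j) ≡ J → P (f i) ⊎ P (h j)) →
    J ≤ # applyUpTo f J + # applyUpTo h J
  count-covering-pairs f h zero    _     = z≤n
  count-covering-pairs f h (suc J) cover = begin
    suc J                                     ≤⟨ split (cover 0 J refl) ⟩
    #f + (B + # (h J ∷ []))                   ≡⟨ cong (#f +_) #-∷ʳ ⟨
    #f + # (applyUpTo h J ++ (h J ∷ []))      ≡⟨ cong (λ xs → #f + # xs) (applyUpTo-∷ʳ h J) ⟩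
    #f + # applyUpTo h (suc J)                ∎
    where
    open ≤-Reasoning
    #f A B : ℕ
    #f = # applyUpTo f (suc J)
    A  = # applyUpTo (f ∘ suc) J
    B  = # applyUpTo h J
    ih : J ≤ A + B
    ih = count-covering-pairs (f ∘ suc) h J λ i j eq → cover (suc i) j (cong suc eq)
    #-∷ʳ : # (applyUpTo h J ++ (h J ∷ [])) ≡ B + # (h J ∷ [])
    #-∷ʳ = trans (cong length (filter-++ P? (applyUpTo h J) (h J ∷ []))) (length-++ (filter P? (applyUpTo h J)))
    split : P (f 0) ⊎ P (h J) →
            suc J ≤ length (filter P? (f 0 ∷ applyUpTo (f ∘ suc) J)) + (B + # (h J ∷ []))
    split c with P? (f 0) | P? (h J) | c
    ... | yes _ | _      | _          = s≤s (≤-trans ih (+-monoʳ-≤ A (m≤m+n B _)))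
    ... | no _  | yes _  | _          = ≤-trans (s≤s ih) (≤-reflexive (sym A+[B+1]≡1+A+B))
      where
      A+[B+1]≡1+A+B : A + (B + 1) ≡ suc (A + B)
      A+[B+1]≡1+A+B = trans (cong (A +_) (+-comm B 1)) (+-suc A B)
    ... | no ¬p | no _   | inj₁ p     = contradiction p ¬p
    ... | no _  | no ¬q  | inj₂ q     = contradiction q ¬q

-- Words over {1, 2, 3}

≡three⇒≢one : ∀ {d} → d ≡ three → d ≢ one
≡three⇒≢one refl ()

-- Positions are 0-based; past the end a word reads as one, the digit that marks no gap.
digitAt : ∀ {L} → Vec Digit L → ℕ → Digit
digitAt []      _       = one
digitAt (d ∷ _) zero    = d
digitAt (_ ∷ w) (suc j) = digitAt w j

digitAt≢one⇒< : ∀ {L} (w : Vec Digit L) {j} → digitAt w j ≢ one → j < L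
digitAt≢one⇒< []      d≢one = ⊥-elim (d≢one refl)
digitAt≢one⇒< (_ ∷ _) {zero}  _     = s≤s z≤n
digitAt≢one⇒< (_ ∷ w) {suc j} d≢one = s≤s (digitAt≢one⇒< w d≢one)

digitAt≡three⇒< : ∀ {L} (w : Vec Digit L) {j} → digitAt w j ≡ three → j < L
digitAt≡three⇒< w ≡three = digitAt≢one⇒< w (≡three⇒≢one ≡three)

lookup≡digitAt : ∀ {L} (w : Vec Digit L) (i : Fin L) → lookup w i ≡ digitAt w (toℕ i)
lookup≡digitAt (_ ∷ _) fzero    = refl
lookup≡digitAt (_ ∷ w) (fsuc i) = lookup≡digitAt w i

digitAt-++ˡ : ∀ {t M} (x : Vec Digit t) (y : Vec Digit M) {j} → j < t → digitAt (x ++ᵛ y) j ≡ digitAt x j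
digitAt-++ˡ (_ ∷ _) y {zero}  _         = refl
digitAt-++ˡ (_ ∷ x) y {suc j} (s≤s j<t) = digitAt-++ˡ x y j<t

digitAt-++ʳ : ∀ {t M} (x : Vec Digit t) (y : Vec Digit M) j → digitAt (x ++ᵛ y) (t + j) ≡ digitAt y j
digitAt-++ʳ []      y j = refl
digitAt-++ʳ (_ ∷ x) y j = digitAt-++ʳ x y j

digitAt-injective : ∀ {L} (w w′ : Vec Digit L) →
                    (∀ j → j < L → digitAt w j ≡ digitAt w′ j) → w ≡ w′
digitAt-injective []      []        _  = refl
digitAt-injective (d ∷ w) (d′ ∷ w′) eq =
  cong₂ _∷_ (eq 0 (s≤s z≤n)) (digitAt-injective w w′ λ j j<L → eq (suc j) (s≤s j<L))

build : (ℕ → Digit) → (L : ℕ) → Vec Digit L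
build f zero    = []
build f (suc L) = f 0 ∷ build (f ∘ suc) L

digitAt-build : ∀ f L {j} → j < L → digitAt (build f L) j ≡ f j
digitAt-build f (suc L) {zero}  _         = refl
digitAt-build f (suc L) {suc j} (s≤s j<L) = digitAt-build (f ∘ suc) L j<L

Digit-≡ : ∀ {d d′ : Digit} → (d ≢ one ⇔ d′ ≢ one) → (d ≡ three ⇔ d′ ≡ three) → d ≡ d′
Digit-≡ {one}   {one}   _ _ = refl
Digit-≡ {two}   {two}   _ _ = refl
Digit-≡ {three} {three} _ _ = refl
Digit-≡ {one}   {two}   ≢one _ = ⊥-elim (Equivalence.from ≢one (λ ()) refl)
Digit-≡ {one}   {three} ≢one _ = ⊥-elim (Equivalence.from ≢one (λ ()) refl)
Digit-≡ {two}   {one}   ≢one _ = ⊥-elim (Equivalence.to ≢one (λ ()) refl)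
Digit-≡ {three} {one}   ≢one _ = ⊥-elim (Equivalence.to ≢one (λ ()) refl)
Digit-≡ {two}   {three} _ ≡three with () ← Equivalence.from ≡three refl
Digit-≡ {three} {two}   _ ≡three with () ← Equivalence.to ≡three refl

notOne? : Decidable (_≢ one)
notOne? d = ¬? (d ≟D one)

count-++ : ∀ {P : Pred Digit 0ℓ} (P? : Decidable P) {t M} (x : Vec Digit t) (y : Vec Digit M) →
           count P? (x ++ᵛ y) ≡ count P? x + count P? y
count-++ P? []      y = refl
count-++ P? (d ∷ x) y with does (P? d)
... | true  = cong suc (count-++ P? x y)
... | false = count-++ P? x y

count-notOne : ∀ {L} (w : Vec Digit L) → count notOne? w ≡ a w + b w
count-notOne []          = refl
count-notOne (one ∷ w)   = count-notOne w
count-notOne (two ∷ w)   = cong suc (count-notOne w)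
count-notOne (three ∷ w) = trans (cong suc (count-notOne w)) (sym (+-suc (a w) (b w)))

weight : ∀ {L} → Vec Digit L → ℕ
weight w = a w + 2 * b w

weight≡count-notOne+b : ∀ {L} (w : Vec Digit L) → weight w ≡ count notOne? w + b w
weight≡count-notOne+b w = trans (regroup (a w) (b w)) (cong (_+ b w) (sym (count-notOne w)))
  where
  regroup : ∀ p q → p + 2 * q ≡ (p + q) + q
  regroup = solve-∀

weight-++ : ∀ {t M} (x : Vec Digit t) (y : Vec Digit M) → weight (x ++ᵛ y) ≡ weight x + weight y
weight-++ x y = begin
  a (x ++ᵛ y) + 2 * b (x ++ᵛ y)         ≡⟨ cong₂ (λ p q → p + 2 * q) (count-++ _ x y) (count-++ _ x y) ⟩
  (a x + a y) + 2 * (b x + b y)         ≡⟨ regroup (a x) (a y) (b x) (b y) ⟩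
  (a x + 2 * b x) + (a y + 2 * b y)     ∎
  where
  open ≡-Reasoning
  regroup : ∀ p p′ q q′ → (p + p′) + 2 * (q + q′) ≡ (p + 2 * q) + (p′ + 2 * q′)
  regroup = solve-∀

b≡0⇒≢three : ∀ {L} (w : Vec Digit L) → b w ≡ 0 → ∀ j → digitAt w j ≢ three
b≡0⇒≢three (one ∷ w)   b≡0 zero    ()
b≡0⇒≢three (two ∷ w)   b≡0 zero    ()
b≡0⇒≢three (one ∷ w)   b≡0 (suc j) = b≡0⇒≢three w b≡0 j
b≡0⇒≢three (two ∷ w)   b≡0 (suc j) = b≡0⇒≢three w b≡0 j

≢three⇒b≡0 : ∀ {L} (w : Vec Digit L) → (∀ j → digitAt w j ≢ three) → b w ≡ 0
≢three⇒b≡0 []          _      = refl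
≢three⇒b≡0 (one ∷ w)   ≢three = ≢three⇒b≡0 w (≢three ∘ suc)
≢three⇒b≡0 (two ∷ w)   ≢three = ≢three⇒b≡0 w (≢three ∘ suc)
≢three⇒b≡0 (three ∷ w) ≢three = ⊥-elim (≢three 0 refl)

positions : ∀ {L} {P : Pred Digit 0ℓ} → Decidable P → ℕ → Vec Digit L → List ℕ
positions P? s []      = []
positions P? s (d ∷ w) = (if does (P? d) then s ∷_ else id) (positions P? (suc s) w)

module _ {P : Pred Digit 0ℓ} (P? : Decidable P) where

  private
    shift : ∀ {L s z d} {w : Vec Digit L} → ∃[ j ] j < L × z ≡ suc s + j × P (digitAt w j) →
            ∃[ j ] j < suc L × z ≡ s + j × P (digitAt (d ∷ w) j)
    shift {s = s} (j , j<L , refl , Pj) = suc j , s≤s j<L , sym (+-suc s j) , Pj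

  ∈-positions⁻ : ∀ {L} s (w : Vec Digit L) {z} → z ∈ positions P? s w →
                 ∃[ j ] j < L × z ≡ s + j × P (digitAt w j)
  ∈-positions⁻ s (d ∷ w) z∈ with P? d | z∈
  ... | yes Pd | here refl = 0 , s≤s z≤n , sym (+-identityʳ s) , Pd
  ... | yes _  | there z∈′ = shift (∈-positions⁻ (suc s) w z∈′)
  ... | no _   | z∈′       = shift (∈-positions⁻ (suc s) w z∈′)

  ∈-positions⁺ : ∀ {L} s (w : Vec Digit L) {j} → j < L → P (digitAt w j) → s + j ∈ positions P? s w
  ∈-positions⁺ s (d ∷ w) {zero} _ Pd with P? d
  ... | yes _  = here (+-identityʳ s)
  ... | no ¬Pd = ⊥-elim (¬Pd Pd)
  ∈-positions⁺ s (d ∷ w) {suc j} (s≤s j<L) Pj with P? d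
  ... | yes _ = there (subst (_∈ positions P? (suc s) w) (sym (+-suc s j)) (∈-positions⁺ (suc s) w j<L Pj))
  ... | no _  = subst (_∈ positions P? (suc s) w) (sym (+-suc s j)) (∈-positions⁺ (suc s) w j<L Pj)

  positions-sorted : ∀ {L} s (w : Vec Digit L) → AllPairs _<_ (positions P? s w)
  positions-sorted s []      = []
  positions-sorted s (d ∷ w) with does (P? d)
  ... | true  = All.tabulate s<rest ∷ positions-sorted (suc s) w
    where
    s<rest : ∀ {z} → z ∈ positions P? (suc s) w → s < z
    s<rest z∈ with j , _ , refl , _ ← ∈-positions⁻ (suc s) w z∈ = m≤m+n (suc s) j
  ... | false = positions-sorted (suc s) w

  length-positions : ∀ {L} s (w : Vec Digit L) → length (positions P? s w) ≡ count P? w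
  length-positions s []      = refl
  length-positions s (d ∷ w) with does (P? d)
  ... | true  = cong suc (length-positions (suc s) w)
  ... | false = length-positions (suc s) w

-- The semigroup encoded by a word

-- Condition (i) of 𝒴(k) in 0-based positions: (p + 1) + (q + 1) = (p + q + 1) + 1.
NoOneOneThree : ∀ {L} → Vec Digit L → Set
NoOneOneThree w = ∀ p q → digitAt w p ≡ one → digitAt w q ≡ one → digitAt w (suc (p + q)) ≢ three

flagsDigit : ∀ {A B : Set} → Dec A → Dec B → Digit
flagsDigit (yes _) _       = three
flagsDigit (no _)  (yes _) = two
flagsDigit (no _)  (no _)  = one

flagsDigit≡three⇔ : ∀ {A B : Set} (A? : Dec A) (B? : Dec B) → flagsDigit A? B? ≡ three ⇔ A
flagsDigit≡three⇔ (yes a) _       = mk⇔ (λ _ → a) (λ _ → refl)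
flagsDigit≡three⇔ (no ¬a) (yes _) = mk⇔ (λ ()) (λ a → contradiction a ¬a)
flagsDigit≡three⇔ (no ¬a) (no _)  = mk⇔ (λ ()) (λ a → contradiction a ¬a)

flagsDigit≢one⇔ : ∀ {A B : Set} (A? : Dec A) (B? : Dec B) → flagsDigit A? B? ≢ one ⇔ (A ⊎ B)
flagsDigit≢one⇔ (yes a)  _        = mk⇔ (λ _ → inj₁ a) (λ _ ())
flagsDigit≢one⇔ (no _)   (yes b)  = mk⇔ (λ _ → inj₂ b) (λ _ ())
flagsDigit≢one⇔ (no ¬a)  (no ¬b)  = mk⇔ (contradiction refl) (λ a⊎b _ → [ ¬a , ¬b ] a⊎b)

module Gaps (L : ℕ) where

  m : ℕ
  m = suc L

  gaps₁ gaps₂ gaps : Vec Digit L → List ℕ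
  gaps₁ w = positions notOne? (suc m) w
  gaps₂ w = positions (_≟D three) (suc (m + m)) w
  gaps  w = applyUpTo suc L ++ gaps₁ w ++ gaps₂ w

  data Gap (w : Vec Digit L) : ℕ → Set where
    below  : ∀ {i} → i < L → Gap w (suc i)
    level₁ : ∀ {j} → digitAt w j ≢ one → Gap w (suc m + j)
    level₂ : ∀ {j} → digitAt w j ≡ three → Gap w (suc (m + m) + j)

  ∈-gaps⁻ : ∀ w {z} → z ∈ gaps w → Gap w z
  ∈-gaps⁻ w z∈ with ∈-++⁻ (applyUpTo suc L) z∈
  ... | inj₁ z∈below with i , i<L , refl ← ∈-applyUpTo⁻ suc z∈below = below i<L
  ... | inj₂ z∈levels with ∈-++⁻ (gaps₁ w) z∈levels
  ... | inj₁ z∈₁ with j , _ , refl , ≢one ← ∈-positions⁻ notOne? (suc m) w z∈₁ = level₁ ≢one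
  ... | inj₂ z∈₂ with j , _ , refl , ≡three ← ∈-positions⁻ (_≟D three) (suc (m + m)) w z∈₂ =
    level₂ ≡three

  ∈-gaps⁺ : ∀ w {z} → Gap w z → z ∈ gaps w
  ∈-gaps⁺ w (below i<L) = ∈-++⁺ˡ (∈-applyUpTo⁺ suc i<L)
  ∈-gaps⁺ w (level₁ ≢one) =
    ∈-++⁺ʳ (applyUpTo suc L) (∈-++⁺ˡ (∈-positions⁺ notOne? (suc m) w (digitAt≢one⇒< w ≢one) ≢one))
  ∈-gaps⁺ w (level₂ ≡three) =
    ∈-++⁺ʳ (applyUpTo suc L) (∈-++⁺ʳ (gaps₁ w)
      (∈-positions⁺ (_≟D three) (suc (m + m)) w (digitAt≡three⇒< w ≡three) ≡three))

  level₁<m+m : ∀ {j} → j < L → suc m + j < m + m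
  level₁<m+m {j} j<L = subst (_< m + m) (+-suc m j) (+-monoʳ-< m (s≤s j<L))

  gaps-sorted : ∀ w → AllPairs _<_ (gaps w)
  gaps-sorted w =
    AllPairs.++⁺ (AllPairs.applyUpTo⁺₁ suc L λ i<j _ → s≤s i<j)
      (AllPairs.++⁺ (positions-sorted notOne? (suc m) w) (positions-sorted (_≟D three) (suc (m + m)) w)
        (All.tabulate λ x∈ → All.tabulate λ y∈ → level₁<level₂ x∈ y∈))
      (All.tabulate λ x∈ → All.tabulate λ y∈ → below<levels x∈ y∈)
    where
    level₁<level₂ : ∀ {x y} → x ∈ gaps₁ w → y ∈ gaps₂ w → x < y
    level₁<level₂ x∈ y∈
      with j , j<L , refl , _ ← ∈-positions⁻ notOne? (suc m) w x∈
         | j′ , _ , refl , _ ← ∈-positions⁻ (_≟D three) (suc (m + m)) w y∈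
      = <-≤-trans (level₁<m+m j<L) (≤-trans (n≤1+n (m + m)) (m≤m+n (suc (m + m)) j′))
    below<levels : ∀ {x y} → x ∈ applyUpTo suc L → y ∈ gaps₁ w ++ gaps₂ w → x < y
    below<levels x∈ y∈ with i , i<L , refl ← ∈-applyUpTo⁻ suc x∈ | ∈-++⁻ (gaps₁ w) y∈
    ... | inj₁ y∈₁ with j , _ , refl , _ ← ∈-positions⁻ notOne? (suc m) w y∈₁ =
      s≤s (≤-trans i<L (≤-trans (n≤1+n L) (m≤m+n m j)))
    ... | inj₂ y∈₂ with j , _ , refl , _ ← ∈-positions⁻ (_≟D three) (suc (m + m)) w y∈₂ =
      s≤s (≤-trans i<L (≤-trans (n≤1+n L) (≤-trans (m≤m+n m m) (m≤m+n (m + m) j))))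

  length-gaps : ∀ w → length (gaps w) ≡ L + weight w
  length-gaps w = begin
    length (gaps w)
      ≡⟨ length-++ (applyUpTo suc L) ⟩
    length (applyUpTo suc L) + length (gaps₁ w ++ gaps₂ w)
      ≡⟨ cong₂ _+_ (length-applyUpTo suc L) (length-++ (gaps₁ w)) ⟩
    L + (length (gaps₁ w) + length (gaps₂ w))
      ≡⟨ cong (L +_) (cong₂ _+_ (length-positions notOne? (suc m) w)
                                (length-positions (_≟D three) (suc (m + m)) w)) ⟩
    L + (count notOne? w + b w)
      ≡⟨ cong (L +_) (weight≡count-notOne+b w) ⟨
    L + weight w ∎
    where open ≡-Reasoning

  level₁-gap : ∀ {w j} → j < L → suc m + j ∈ gaps w → digitAt w j ≢ one
  level₁-gap {w} {j} j<L j∈ = go (∈-gaps⁻ w j∈) refl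
    where
    go : ∀ {z} → Gap w z → z ≡ suc m + j → digitAt w j ≢ one
    go (below i<L)       eq = contradiction i<L (<-asym (subst (m ≤_) (sym (suc-injective eq)) (m≤m+n m j)))
    go (level₁ ≢one)     eq = subst (λ j → digitAt w j ≢ one) (+-cancelˡ-≡ (suc m) _ _ eq) ≢one
    go (level₂ {j′} _)   eq = contradiction j<L (<-asym (subst (m ≤_) m+j′≡j (m≤m+n m j′)))
      where
      m+j′≡j : m + j′ ≡ j
      m+j′≡j = +-cancelˡ-≡ m _ _ (trans (sym (+-assoc m m j′)) (suc-injective eq))

  level₂-gap : ∀ {w j} → suc (m + m) + j ∈ gaps w → digitAt w j ≡ three
  level₂-gap {w} {j} j∈ = go (∈-gaps⁻ w j∈) refl
    where
    go : ∀ {z} → Gap w z → z ≡ suc (m + m) + j → digitAt w j ≡ three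
    go (below i<L)        eq = contradiction i<L
      (<-asym (subst (m ≤_) (sym (suc-injective eq)) (≤-trans (m≤m+n m m) (m≤m+n (m + m) j))))
    go (level₁ {j′} ≢one) eq =
      contradiction (digitAt≢one⇒< w ≢one) (<-asym (subst (m ≤_) (sym j′≡m+j) (m≤m+n m j)))
      where
      j′≡m+j : j′ ≡ m + j
      j′≡m+j = +-cancelˡ-≡ m _ _ (trans (suc-injective eq) (+-assoc m m j))
    go (level₂ ≡three)    eq = subst (λ j → digitAt w j ≡ three) (+-cancelˡ-≡ (suc (m + m)) _ _ eq) ≡three

  decode : List ℕ → Vec Digit L
  decode G = build (λ j → flagsDigit (suc (m + m) + j ∈? G) (suc m + j ∈? G)) L

  decode≡three⇔ : ∀ G {j} → j < L → digitAt (decode G) j ≡ three ⇔ suc (m + m) + j ∈ G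
  decode≡three⇔ G {j} j<L =
    subst (λ d → d ≡ three ⇔ suc (m + m) + j ∈ G) (sym (digitAt-build _ L j<L)) (flagsDigit≡three⇔ _ _)

  decode≢one⇔ : ∀ G {j} → j < L → digitAt (decode G) j ≢ one ⇔ (suc (m + m) + j ∈ G ⊎ suc m + j ∈ G)
  decode≢one⇔ G {j} j<L =
    subst (λ d → d ≢ one ⇔ (suc (m + m) + j ∈ G ⊎ suc m + j ∈ G)) (sym (digitAt-build _ L j<L))
      (flagsDigit≢one⇔ _ _)

  decode-gaps : ∀ w → decode (gaps w) ≡ w
  decode-gaps w = digitAt-injective _ _ λ j j<L → Digit-≡
    (⇔.trans (decode≢one⇔ (gaps w) j<L)
      (mk⇔ [ ≡three⇒≢one ∘ level₂-gap {w} , level₁-gap {w} j<L ] (inj₂ ∘ ∈-gaps⁺ w ∘ level₁)))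
    (⇔.trans (decode≡three⇔ (gaps w) j<L) (mk⇔ (level₂-gap {w}) (∈-gaps⁺ w ∘ level₂)))

  gaps-injective : Injective _≡_ _≡_ gaps
  gaps-injective {w} {w′} eq = begin
    w                ≡⟨ decode-gaps w ⟨
    decode (gaps w)  ≡⟨ cong decode eq ⟩
    decode (gaps w′) ≡⟨ decode-gaps w′ ⟩
    w′               ∎
    where open ≡-Reasoning

module _ {L : ℕ} (w : Vec Digit L) (noOneOneThree : NoOneOneThree w) where
  open Gaps L

  private
    nonGap₁⇒one : ∀ {j} → suc m + j ∉ gaps w → digitAt w j ≡ one
    nonGap₁⇒one {j} j∉ with digitAt w j ≟D one
    ... | yes ≡one = ≡one
    ... | no ≢one  = contradiction (∈-gaps⁺ w (level₁ ≢one)) j∉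

    m+1+j∉⇒one : ∀ {j} → m + suc j ∉ gaps w → digitAt w j ≡ one
    m+1+j∉⇒one {j} j∉ = nonGap₁⇒one (subst (_∉ gaps w) (+-suc m j) j∉)

    positive-nonGap⇒L≤ : ∀ {x} → suc x ∉ gaps w → L ≤ x
    positive-nonGap⇒L≤ {x} x∉ with x <? L
    ... | yes x<L = contradiction (∈-gaps⁺ w (below x<L)) x∉
    ... | no x≮L  = ≮⇒≥ x≮L

    -- Two elements m + i₁, m + i₂ of the semigroup can only sum to a gap of the form 2m + 1 + j,
    -- and then either one of them is m + 1 + j or they are m + 1 + p, m + 1 + q with j = p + q + 1.
    sum-of-nonGaps : ∀ {z i₁ i₂} → Gap w z → z ≡ (m + i₁) + (m + i₂) →
                     m + i₁ ∉ gaps w → m + i₂ ∉ gaps w → ⊥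
    sum-of-nonGaps {i₁ = i₁} {i₂} (below i<L) eq _ _ =
      contradiction i<L (≤⇒≯ (s≤s⁻¹ (subst (m ≤_) (sym eq) (≤-trans (m≤m+n m i₁) (m≤m+n _ (m + i₂))))))
    sum-of-nonGaps {i₁ = i₁} {i₂} (level₁ ≢one) eq _ _ =
      <-irrefl eq (<-≤-trans (level₁<m+m (digitAt≢one⇒< w ≢one))
                             (+-mono-≤ (m≤m+n m i₁) (m≤m+n m i₂)))
    sum-of-nonGaps {i₁ = i₁} {i₂} (level₂ {j} ≡three) eq = split i₁ i₂ i₁+i₂≡1+j
      where
      regroup : ∀ m i₁ i₂ → (m + i₁) + (m + i₂) ≡ (m + m) + (i₁ + i₂)
      regroup = solve-∀
      i₁+i₂≡1+j : i₁ + i₂ ≡ suc j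
      i₁+i₂≡1+j = sym (+-cancelˡ-≡ (m + m) _ _ (trans (+-suc (m + m) j) (trans eq (regroup m i₁ i₂))))
      split : ∀ i₁ i₂ → i₁ + i₂ ≡ suc j → m + i₁ ∉ gaps w → m + i₂ ∉ gaps w → ⊥
      split zero    i₂      refl _  y∉ = ≡three⇒≢one ≡three (m+1+j∉⇒one y∉)
      split (suc p) zero    eq   x∉ _  = ≡three⇒≢one ≡three (subst (λ k → digitAt w k ≡ one) p≡j (m+1+j∉⇒one x∉))
        where
        p≡j : p ≡ j
        p≡j = suc-injective (trans (sym (+-identityʳ (suc p))) eq)
      split (suc p) (suc q) eq   x∉ y∉ =
        noOneOneThree p q (m+1+j∉⇒one x∉) (m+1+j∉⇒one y∉)
          (subst (λ k → digitAt w k ≡ three) (trans (suc-injective (sym eq)) (+-suc p q)) ≡three)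

  gaps-closed : ∀ x y → x ∉ gaps w → y ∉ gaps w → x + y ∉ gaps w
  gaps-closed zero    y       _  y∉ = y∉
  gaps-closed (suc x) zero    x∉ _  = subst (_∉ gaps w) (sym (+-identityʳ (suc x))) x∉
  gaps-closed (suc x) (suc y) x∉ y∉ x+y∈
    with i₁ , refl ← m≤n⇒∃[o]m+o≡n (positive-nonGap⇒L≤ x∉)
       | i₂ , refl ← m≤n⇒∃[o]m+o≡n (positive-nonGap⇒L≤ y∉)
    = sum-of-nonGaps (∈-gaps⁻ w x+y∈) refl x∉ y∉

  gaps-semigroup : InSgWithMult (L + weight w) m (gaps w)
  gaps-semigroup =
    record { canonical = AllPairs⇒Linked (gaps-sorted w)
           ; zero∈S    = 0∉ ∘ ∈-gaps⁻ w
           ; closed    = gaps-closed } ,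
    length-gaps w ,
    (s≤s z≤n , (λ m∈ → m∉ (∈-gaps⁻ w m∈) refl) ,
     λ { (suc i) _ (s≤s i<L) i∉ → i∉ (∈-gaps⁺ w (below i<L)) })
    where
    0∉ : ¬ Gap w 0
    0∉ ()
    m∉ : ∀ {z} → Gap w z → z ≢ m
    m∉ (below i<L)     eq = <-irrefl (suc-injective eq) i<L
    m∉ (level₁ {j} _)  eq = <-irrefl (sym eq) (s≤s (m≤m+n m j))
    m∉ (level₂ {j} _)  eq = <-irrefl (sym eq) (s≤s (≤-trans (m≤m+n m m) (m≤m+n (m + m) j)))

-- Decoding a semigroup

module Decoding {L n : ℕ} {G : List ℕ} (t≤L : 2 * n ∸ 1 ≤ L)
                (G-semigroup : InSgWithMult (L + n) (suc L) G) where
  open Gaps L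
  open IsNumericalSemigroup (proj₁ G-semigroup)

  private
    genus≡ : length G ≡ L + n
    genus≡ = proj₁ (proj₂ G-semigroup)

    m∉G : m ∉ G
    m∉G = proj₁ (proj₂ (proj₂ (proj₂ G-semigroup)))

    below-m∈G : ∀ z → 0 < z → z < m → ¬ z ∉ G
    below-m∈G = proj₂ (proj₂ (proj₂ (proj₂ G-semigroup)))

    below∈G : ∀ {i} → i < L → suc i ∈ G
    below∈G {i} i<L = decidable-stable (suc i ∈? G) (below-m∈G (suc i) (s≤s z≤n) (s≤s i<L))

    summand∈G : ∀ {x y} → x + y ∈ G → x ∈ G ⊎ y ∈ G
    summand∈G {x} {y} x+y∈ with x ∈? G | y ∈? G
    ... | yes x∈ | _      = inj₁ x∈
    ... | no _   | yes y∈ = inj₂ y∈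
    ... | no x∉  | no y∉  = contradiction x+y∈ (closed x y x∉ y∉)

    m+y∈G⇒y∈G : ∀ {y} → m + y ∈ G → y ∈ G
    m+y∈G⇒y∈G m+y∈ = [ (λ m∈ → contradiction m∈ m∉G) , id ] (summand∈G m+y∈)

  gaps-above-m : ∀ {es} → AllPairs _<_ es → (∀ {z} → z ∈ es → m < z) → es ⊆ G → length es ≤ n
  gaps-above-m {es} sorted m<es es⊆G = +-cancelˡ-≤ L (length es) n (begin
    L + length es                        ≡⟨ cong (_+ length es) (length-applyUpTo suc L) ⟨
    length (applyUpTo suc L) + length es ≡⟨ length-++ (applyUpTo suc L) ⟨
    length (applyUpTo suc L ++ es)       ≤⟨ Unique⇒length≤ (AllPairs.map <⇒≢ below++es-sorted) below++es⊆G ⟩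
    length G                             ≡⟨ genus≡ ⟩
    L + n                                ∎)
    where
    open ≤-Reasoning
    below++es-sorted : AllPairs _<_ (applyUpTo suc L ++ es)
    below++es-sorted = AllPairs.++⁺ (AllPairs.applyUpTo⁺₁ suc L λ i<j _ → s≤s i<j) sorted
      (All.tabulate λ x∈ → All.tabulate λ y∈ → below<es x∈ (m<es y∈))
      where
      below<es : ∀ {x y} → x ∈ applyUpTo suc L → m < y → x < y
      below<es x∈ m<y with i , i<L , refl ← ∈-applyUpTo⁻ suc x∈ = ≤-trans (s≤s i<L) (<⇒≤ m<y)
    below++es⊆G : applyUpTo suc L ++ es ⊆ G
    below++es⊆G z∈ with ∈-++⁻ (applyUpTo suc L) z∈
    ... | inj₁ z∈below with i , i<L , refl ← ∈-applyUpTo⁻ suc z∈below = below∈G i<L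
    ... | inj₂ z∈es = es⊆G z∈es

  -- With b₀ = m + 1 + J + s, the gap e = m + b₀ + J is the sum of (m + 1 + i) and (b₀ + j) whenever
  -- i + j + 1 = J, so these J disjoint pairs contribute J gaps; b₀ + J and e are two more.
  pair-gaps : ∀ J s → suc (m + m) + (J + J + s) ∈ G → J + 2 ≤ n
  pair-gaps J s e∈ = ≤-trans J+2≤#es (gaps-above-m es-sorted m<es es⊆G)
    where
    b₀ e : ℕ
    b₀ = suc m + J + s
    e  = m + (b₀ + J)

    e∈G : e ∈ G
    e∈G = subst (_∈ G) (regroup m J s) e∈
      where
      regroup : ∀ m J s → suc (m + m) + (J + J + s) ≡ m + ((suc m + J + s) + J)
      regroup = solve-∀

    A B es : List ℕ
    A  = filter (_∈? G) (applyUpTo (suc m +_) J)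
    B  = filter (_∈? G) (applyUpTo (b₀ +_) J)
    es = A ++ B ++ (b₀ + J) ∷ e ∷ []

    ∈A⁻ : ∀ {z} → z ∈ A → z ∈ applyUpTo (suc m +_) J × z ∈ G
    ∈A⁻ = ∈-filter⁻ (_∈? G) {xs = applyUpTo (suc m +_) J}

    ∈B⁻ : ∀ {z} → z ∈ B → z ∈ applyUpTo (b₀ +_) J × z ∈ G
    ∈B⁻ = ∈-filter⁻ (_∈? G) {xs = applyUpTo (b₀ +_) J}

    A-bounds : ∀ {z} → z ∈ A → m < z × z < b₀
    A-bounds z∈ with i , i<J , refl ← ∈-applyUpTo⁻ (suc m +_) (proj₁ (∈A⁻ z∈)) =
      s≤s (m≤m+n m i) , <-≤-trans (+-monoʳ-< (suc m) i<J) (m≤m+n (suc m + J) s)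

    B-bounds : ∀ {z} → z ∈ B → b₀ ≤ z × z < b₀ + J
    B-bounds z∈ with j , j<J , refl ← ∈-applyUpTo⁻ (b₀ +_) (proj₁ (∈B⁻ z∈)) =
      m≤m+n b₀ j , +-monoʳ-< b₀ j<J

    b₀+J<e : b₀ + J < e
    b₀+J<e = m<n+m (b₀ + J) (s≤s z≤n)

    m<b₀ : m < b₀
    m<b₀ = ≤-trans (m≤m+n (suc m) J) (m≤m+n (suc m + J) s)

    tail-bounds : ∀ {z} → z ∈ (b₀ + J) ∷ e ∷ [] → b₀ + J ≤ z
    tail-bounds (here refl)         = ≤-refl
    tail-bounds (there (here refl)) = <⇒≤ b₀+J<e

    es-sorted : AllPairs _<_ es
    es-sorted =
      AllPairs.++⁺ (AllPairs.filter⁺ (_∈? G) (run-sorted (suc m)))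
        (AllPairs.++⁺ (AllPairs.filter⁺ (_∈? G) (run-sorted b₀))
          ((b₀+J<e ∷ []) ∷ [] ∷ [])
          (All.tabulate λ x∈ → All.tabulate λ y∈ → <-≤-trans (proj₂ (B-bounds x∈)) (tail-bounds y∈)))
        (All.tabulate λ x∈ → All.tabulate λ y∈ → <-≤-trans (proj₂ (A-bounds x∈)) (b₀≤ y∈))
      where
      run-sorted : ∀ s → AllPairs _<_ (applyUpTo (s +_) J)
      run-sorted s = AllPairs.applyUpTo⁺₁ (s +_) J λ i<j _ → +-monoʳ-< s i<j
      b₀≤ : ∀ {z} → z ∈ B ++ (b₀ + J) ∷ e ∷ [] → b₀ ≤ z
      b₀≤ z∈ with ∈-++⁻ B z∈
      ... | inj₁ z∈B    = proj₁ (B-bounds z∈B)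
      ... | inj₂ z∈tail = ≤-trans (m≤m+n b₀ J) (tail-bounds z∈tail)

    m<es : ∀ {z} → z ∈ es → m < z
    m<es z∈ with ∈-++⁻ A z∈
    ... | inj₁ z∈A = proj₁ (A-bounds z∈A)
    ... | inj₂ z∈B++tail with ∈-++⁻ B z∈B++tail
    ... | inj₁ z∈B    = <-≤-trans m<b₀ (proj₁ (B-bounds z∈B))
    ... | inj₂ z∈tail = <-≤-trans m<b₀ (≤-trans (m≤m+n b₀ J) (tail-bounds z∈tail))

    es⊆G : es ⊆ G
    es⊆G z∈ with ∈-++⁻ A z∈
    ... | inj₁ z∈A = proj₂ (∈A⁻ z∈A)
    ... | inj₂ z∈B++tail with ∈-++⁻ B z∈B++tail
    ... | inj₁ z∈B                   = proj₂ (∈B⁻ z∈B)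
    ... | inj₂ (here refl)           = m+y∈G⇒y∈G e∈G
    ... | inj₂ (there (here refl))   = e∈G

    cover : ∀ i j → suc (i + j) ≡ J → suc m + i ∈ G ⊎ b₀ + j ∈ G
    cover i j i+j+1≡J = summand∈G (subst (_∈ G) e≡ e∈G)
      where
      regroup : ∀ m b i j → m + (b + suc (i + j)) ≡ (suc m + i) + (b + j)
      regroup = solve-∀
      e≡ : e ≡ (suc m + i) + (b₀ + j)
      e≡ = trans (cong (λ k → m + (b₀ + k)) (sym i+j+1≡J)) (regroup m b₀ i j)

    #A+#B : J ≤ length A + length B
    #A+#B = count-covering-pairs (_∈? G) (suc m +_) (b₀ +_) J cover

    J+2≤#es : J + 2 ≤ length es
    J+2≤#es = begin
      J + 2                                      ≤⟨ +-monoˡ-≤ 2 #A+#B ⟩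
      (length A + length B) + 2                  ≡⟨ +-assoc (length A) (length B) 2 ⟩
      length A + (length B + 2)             ≡⟨ cong (length A +_) (length-++ B) ⟨
      length A + length (B ++ (b₀ + J) ∷ e ∷ []) ≡⟨ length-++ A ⟨
      length es                             ∎
      where open ≤-Reasoning

  private
    halves≤ : ∀ n → (n ∸ 1) + (n ∸ 1) ≤ 2 * n ∸ 1
    halves≤ zero    = z≤n
    halves≤ (suc n) = +-monoʳ-≤ n (≤-trans (≤-reflexive (sym (+-identityʳ n))) (n≤1+n (n + 0)))

    pred+2≰ : ∀ n → (n ∸ 1) + 2 ≰ n
    pred+2≰ zero    ()
    pred+2≰ (suc n) le = n≮n n (s≤s⁻¹ (subst (_≤ suc n) (+-comm n 2) le))

  level₂-bound : ∀ {j} → suc (m + m) + j ∈ G → j < 2 * n ∸ 1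
  level₂-bound {j} j∈ with j <? 2 * n ∸ 1
  ... | yes j<t = j<t
  ... | no j≮t with s , refl ← m≤n⇒∃[o]m+o≡n (≤-trans (halves≤ n) (≮⇒≥ j≮t)) =
    contradiction (pair-gaps (n ∸ 1) s j∈) (pred+2≰ n)

  private
    data Zone : ℕ → Set where
      origin       : Zone 0
      small        : ∀ {i} → i < L → Zone (suc i)
      multiplicity : Zone m
      band₁        : ∀ {j} → j < L → Zone (suc m + j)
      twice        : Zone (m + m)
      band₂        : ∀ j → Zone (suc (m + m) + j)

    zone-beyond : ∀ e → Zone (m + suc (L + e))
    zone-beyond zero     = subst (λ k → Zone (m + suc k)) (sym (+-identityʳ L)) twice
    zone-beyond (suc e′) = subst Zone (regroup L e′) (band₂ e′)
      where
      regroup : ∀ L e → suc (suc L + suc L) + e ≡ suc L + suc (L + suc e)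
      regroup = solve-∀

    zone-above : ∀ d → Zone (m + d)
    zone-above zero = subst Zone (sym (+-identityʳ m)) multiplicity
    zone-above (suc j) with j <? L
    ... | yes j<L = subst Zone (sym (+-suc m j)) (band₁ j<L)
    ... | no j≮L with e , refl ← m≤n⇒∃[o]m+o≡n (≮⇒≥ j≮L) = zone-beyond e

    zone : ∀ z → Zone z
    zone zero = origin
    zone (suc i) with i <? L
    ... | yes i<L = small i<L
    ... | no i≮L with d , refl ← m≤n⇒∃[o]m+o≡n (≮⇒≥ i≮L) = zone-above d

    sum-of-level₁ : ∀ m p q → suc (m + m) + suc (p + q) ≡ (suc m + p) + (suc m + q)
    sum-of-level₁ = solve-∀

    m+m+1+j≡m+[m+1+j] : ∀ j → suc (m + m) + j ≡ m + (suc m + j)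
    m+m+1+j≡m+[m+1+j] j = trans (cong suc (+-assoc m m j)) (sym (+-suc m (m + j)))

    decode-three⇒ : ∀ {j} → digitAt (decode G) j ≡ three → suc (m + m) + j ∈ G
    decode-three⇒ ≡three = Equivalence.to (decode≡three⇔ G (digitAt≡three⇒< (decode G) ≡three)) ≡three

    level₁∈G⇒≢one : ∀ {j} → j < L → suc m + j ∈ G → digitAt (decode G) j ≢ one
    level₁∈G⇒≢one j<L j∈ = Equivalence.from (decode≢one⇔ G j<L) (inj₂ j∈)

    decode≢one⇒ : ∀ {j} → digitAt (decode G) j ≢ one → suc m + j ∈ G
    decode≢one⇒ {j} ≢one with Equivalence.to (decode≢one⇔ G (digitAt≢one⇒< (decode G) ≢one)) ≢one
    ... | inj₁ level₂∈ = m+y∈G⇒y∈G (subst (_∈ G) (m+m+1+j≡m+[m+1+j] j) level₂∈)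
    ... | inj₂ level₁∈ = level₁∈

    ∈G⇒Gap : ∀ {z} → z ∈ G → Gap (decode G) z
    ∈G⇒Gap {z} z∈ with zone z
    ... | origin       = contradiction z∈ zero∈S
    ... | small i<L    = below i<L
    ... | multiplicity = contradiction z∈ m∉G
    ... | band₁ j<L    = level₁ (level₁∈G⇒≢one j<L z∈)
    ... | twice        = contradiction z∈ (closed m m m∉G m∉G)
    ... | band₂ j      = level₂ (Equivalence.from (decode≡three⇔ G j<L) z∈)
      where
      j<L : j < L
      j<L = <-≤-trans (level₂-bound z∈) t≤L

    Gap⇒∈G : ∀ {z} → Gap (decode G) z → z ∈ G
    Gap⇒∈G (below i<L)     = below∈G i<L
    Gap⇒∈G (level₁ ≢one)   = decode≢one⇒ ≢one
    Gap⇒∈G (level₂ ≡three) = decode-three⇒ ≡three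

  G≡gaps-decode : G ≡ gaps (decode G)
  G≡gaps-decode = strictlySorted-≡ (Linked⇒AllPairs <-trans canonical) (gaps-sorted (decode G))
    (∈-gaps⁺ (decode G) ∘ ∈G⇒Gap) (Gap⇒∈G ∘ ∈-gaps⁻ (decode G))

  weight-decode : weight (decode G) ≡ n
  weight-decode = +-cancelˡ-≡ L _ _ (begin
    L + weight (decode G)      ≡⟨ length-gaps (decode G) ⟨
    length (gaps (decode G))   ≡⟨ cong length G≡gaps-decode ⟨
    length G                   ≡⟨ genus≡ ⟩
    L + n                      ∎)
    where open ≡-Reasoning

  decode-threesBelow : ∀ j → digitAt (decode G) j ≡ three → j < 2 * n ∸ 1
  decode-threesBelow j = level₂-bound ∘ decode-three⇒

  decode-noOneOneThree : NoOneOneThree (decode G)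
  decode-noOneOneThree p q ≡one ≡one′ ≡three
    with summand∈G (subst (_∈ G) (sum-of-level₁ m p q) (decode-three⇒ ≡three))
  ... | inj₁ p∈ = level₁∈G⇒≢one (<-trans (s≤s (m≤m+n p q)) (digitAt≡three⇒< (decode G) ≡three)) p∈ ≡one
  ... | inj₂ q∈ = level₁∈G⇒≢one (<-trans (s≤s (m≤n+m q p)) (digitAt≡three⇒< (decode G) ≡three)) q∈ ≡one′

-- Enumerating the words

wordsWithTwos : (M r : ℕ) → List (Vec Digit M)
wordsWithTwos zero    zero    = [] ∷ []
wordsWithTwos zero    (suc r) = []
wordsWithTwos (suc M) zero    = map (one ∷_) (wordsWithTwos M zero)
wordsWithTwos (suc M) (suc r) = map (two ∷_) (wordsWithTwos M r) ++ map (one ∷_) (wordsWithTwos M (suc r))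

∈-wordsWithTwos⁺ : ∀ {M} (y : Vec Digit M) r → b y ≡ 0 → a y ≡ r → y ∈ wordsWithTwos M r
∈-wordsWithTwos⁺ []          zero    _   _   = here refl
∈-wordsWithTwos⁺ (one ∷ y)   zero    b≡0 a≡r = ∈-map⁺ (one ∷_) (∈-wordsWithTwos⁺ y zero b≡0 a≡r)
∈-wordsWithTwos⁺ {suc M} (one ∷ y) (suc r) b≡0 a≡r =
  ∈-++⁺ʳ (map (two ∷_) (wordsWithTwos M r)) (∈-map⁺ (one ∷_) (∈-wordsWithTwos⁺ y (suc r) b≡0 a≡r))
∈-wordsWithTwos⁺ (two ∷ y)   (suc r) b≡0 a≡r =
  ∈-++⁺ˡ (∈-map⁺ (two ∷_) (∈-wordsWithTwos⁺ y r b≡0 (suc-injective a≡r)))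

∈-wordsWithTwos⁻ : ∀ M r {y : Vec Digit M} → y ∈ wordsWithTwos M r → b y ≡ 0 × a y ≡ r
∈-wordsWithTwos⁻ zero    zero    (here refl) = refl , refl
∈-wordsWithTwos⁻ (suc M) zero    y∈ with y′ , y′∈ , refl ← ∈-map⁻ (one ∷_) y∈ =
  ∈-wordsWithTwos⁻ M zero y′∈
∈-wordsWithTwos⁻ (suc M) (suc r) y∈ with ∈-++⁻ (map (two ∷_) (wordsWithTwos M r)) y∈
... | inj₁ y∈₂ with y′ , y′∈ , refl ← ∈-map⁻ (two ∷_) y∈₂ =
  let b≡0 , a≡r = ∈-wordsWithTwos⁻ M r y′∈ in b≡0 , cong suc a≡r
... | inj₂ y∈₁ with y′ , y′∈ , refl ← ∈-map⁻ (one ∷_) y∈₁ =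
  ∈-wordsWithTwos⁻ M (suc r) y′∈

wordsWithTwos-unique : ∀ M r → Unique (wordsWithTwos M r)
wordsWithTwos-unique zero    zero    = [] ∷ []
wordsWithTwos-unique zero    (suc r) = []
wordsWithTwos-unique (suc M) zero    = Unique.map⁺ Vec.∷-injectiveʳ (wordsWithTwos-unique M zero)
wordsWithTwos-unique (suc M) (suc r) =
  Unique.++⁺ (Unique.map⁺ Vec.∷-injectiveʳ (wordsWithTwos-unique M r))
             (Unique.map⁺ Vec.∷-injectiveʳ (wordsWithTwos-unique M (suc r)))
             λ (y∈₂ , y∈₁) → disjoint y∈₂ y∈₁
  where
  disjoint : ∀ {y} → y ∈ map (two ∷_) (wordsWithTwos M r) → ¬ y ∈ map (one ∷_) (wordsWithTwos M (suc r))
  disjoint y∈₂ y∈₁ with _ , _ , refl ← ∈-map⁻ (two ∷_) y∈₂ with () ← ∈-map⁻ (one ∷_) y∈₁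

length-wordsWithTwos : ∀ M r → length (wordsWithTwos M r) ≡ M C r
length-wordsWithTwos zero    zero    = refl
length-wordsWithTwos zero    (suc r) = refl
length-wordsWithTwos (suc M) zero    =
  trans (length-map (one ∷_) (wordsWithTwos M zero)) (length-wordsWithTwos M zero)
length-wordsWithTwos (suc M) (suc r) = begin
  length (map (two ∷_) (wordsWithTwos M r) ++ map (one ∷_) (wordsWithTwos M (suc r)))
    ≡⟨ length-++ (map (two ∷_) (wordsWithTwos M r)) ⟩
  length (map (two ∷_) (wordsWithTwos M r)) + length (map (one ∷_) (wordsWithTwos M (suc r)))
    ≡⟨ cong₂ _+_ (length-map (two ∷_) (wordsWithTwos M r)) (length-map (one ∷_) (wordsWithTwos M (suc r))) ⟩
  length (wordsWithTwos M r) + length (wordsWithTwos M (suc r))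
    ≡⟨ cong₂ _+_ (length-wordsWithTwos M r) (length-wordsWithTwos M (suc r)) ⟩
  M C r + M C suc r
    ≡⟨ nCk+nC[k+1]≡[n+1]C[k+1] M r ⟩
  suc M C suc r ∎
  where open ≡-Reasoning

∈-tuples : ∀ t (x : Vec Digit t) → x ∈ tuples t
∈-tuples zero    []      = here refl
∈-tuples (suc t) (d ∷ x) = ∈-concatMap⁺ extend (lose (∈-tuples t x) (extensions d))
  where
  extend : Vec Digit t → List (Vec Digit (suc t))
  extend v = (one ∷ v) ∷ (two ∷ v) ∷ (three ∷ v) ∷ []
  extensions : ∀ d → d ∷ x ∈ extend x
  extensions one   = here refl
  extensions two   = there (here refl)
  extensions three = there (there (here refl))

tuples-unique : ∀ t → Unique (tuples t)
tuples-unique zero    = [] ∷ []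
tuples-unique (suc t) = Unique-concatMap _ (tuples-unique t)
  (λ _ → ((λ ()) ∷ (λ ()) ∷ []) ∷ ((λ ()) ∷ []) ∷ [] ∷ [])
  (λ x∈ x∈′ → trans (sym (tail-extension x∈)) (tail-extension x∈′))
  where
  tail-extension : ∀ {x : Vec Digit t} {x′} → x′ ∈ (one ∷ x) ∷ (two ∷ x) ∷ (three ∷ x) ∷ [] → tail x′ ≡ x
  tail-extension (here refl)                 = refl
  tail-extension (there (here refl))         = refl
  tail-extension (there (there (here refl))) = refl

∈-Y⁺ : ∀ k1 {x} → InY k1 x → x ∈ Y k1
∈-Y⁺ k1 {x} = ∈-filter⁺ (inY? k1) (∈-tuples _ x)

∈-Y⁻ : ∀ k1 {x} → x ∈ Y k1 → InY k1 x
∈-Y⁻ k1 x∈ = proj₂ (∈-filter⁻ (inY? k1) {xs = tuples (2 * k1 ∸ 1)} x∈)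

Y-unique : ∀ k1 → Unique (Y k1)
Y-unique k1 = Unique.filter⁺ (inY? k1) (tuples-unique _)

module _ {t M} (x : Vec Digit t) (y : Vec Digit M) where

  private
    digitAt-++≡lookup : ∀ i → digitAt (x ++ᵛ y) (toℕ i) ≡ lookup x i
    digitAt-++≡lookup i = trans (digitAt-++ˡ x y (toℕ<n i)) (sym (lookup≡digitAt x i))

    lookup-fromℕ< : ∀ {j d} (j<t : j < t) → digitAt (x ++ᵛ y) j ≡ d → lookup x (fromℕ< j<t) ≡ d
    lookup-fromℕ< j<t ≡d =
      trans (sym (digitAt-++≡lookup (fromℕ< j<t))) (trans (cong (digitAt (x ++ᵛ y)) (toℕ-fromℕ< j<t)) ≡d)

    1-based : ∀ p q → (p + 1) + (q + 1) ≡ suc (p + q) + 1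
    1-based = solve-∀

  noOneOneThree⇒CondI : NoOneOneThree (x ++ᵛ y) → CondI x
  noOneOneThree⇒CondI noOneOneThree i₁ i₂ i₃ sum≡ (≡one , ≡one′ , ≡three) =
    noOneOneThree (toℕ i₁) (toℕ i₂)
      (trans (digitAt-++≡lookup i₁) ≡one) (trans (digitAt-++≡lookup i₂) ≡one′)
      (subst (λ k → digitAt (x ++ᵛ y) k ≡ three) i₃≡ (trans (digitAt-++≡lookup i₃) ≡three))
    where
    i₃≡ : toℕ i₃ ≡ suc (toℕ i₁ + toℕ i₂)
    i₃≡ = +-cancelʳ-≡ 1 _ _ (trans (sym sum≡) (1-based (toℕ i₁) (toℕ i₂)))

  CondI⇒noOneOneThree : CondI x → b y ≡ 0 → NoOneOneThree (x ++ᵛ y)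
  CondI⇒noOneOneThree condI b≡0 p q ≡one ≡one′ ≡three with suc (p + q) <? t
  ... | yes r<t = condI (fromℕ< p<t) (fromℕ< q<t) (fromℕ< r<t) sum≡
    (lookup-fromℕ< p<t ≡one , lookup-fromℕ< q<t ≡one′ , lookup-fromℕ< r<t ≡three)
    where
    p<t : p < t
    p<t = ≤-<-trans (m≤m+n p q) (<-trans (n<1+n (p + q)) r<t)
    q<t : q < t
    q<t = ≤-<-trans (m≤n+m q p) (<-trans (n<1+n (p + q)) r<t)
    sum≡ : (toℕ (fromℕ< p<t) + 1) + (toℕ (fromℕ< q<t) + 1) ≡ toℕ (fromℕ< r<t) + 1
    sum≡ rewrite toℕ-fromℕ< p<t | toℕ-fromℕ< q<t | toℕ-fromℕ< r<t = 1-based p q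
  ... | no r≮t with j , j≡ ← m≤n⇒∃[o]m+o≡n (≮⇒≥ r≮t) =
    b≡0⇒≢three y b≡0 j
      (trans (sym (digitAt-++ʳ x y j)) (subst (λ k → digitAt (x ++ᵛ y) k ≡ three) (sym j≡) ≡three))

weight-++-noThree : ∀ {t M} (x : Vec Digit t) (y : Vec Digit M) → b y ≡ 0 →
                    weight (x ++ᵛ y) ≡ weight x + a y
weight-++-noThree x y b≡0 = trans (weight-++ x y) (cong (weight x +_) weight-y)
  where
  weight-y : a y + 2 * b y ≡ a y
  weight-y = trans (cong (λ k → a y + 2 * k) b≡0) (+-identityʳ (a y))

admissibleWords : (n M : ℕ) → List (Vec Digit (2 * n ∸ 1 + M))
admissibleWords n M = concatMap (λ x → map (x ++ᵛ_) (wordsWithTwos M (n ∸ weight x))) (Y n)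

module _ (n M : ℕ) where

  private
    extensions : Vec Digit (2 * n ∸ 1) → List (Vec Digit (2 * n ∸ 1 + M))
    extensions x = map (x ++ᵛ_) (wordsWithTwos M (n ∸ weight x))

  ∈-admissibleWords⁻ : ∀ {w} → w ∈ admissibleWords n M → NoOneOneThree w × weight w ≡ n
  ∈-admissibleWords⁻ w∈
    with x , x∈Y , w∈ext ← find (∈-concatMap⁻ extensions {xs = Y n} w∈)
    with y , y∈ , refl ← ∈-map⁻ (x ++ᵛ_) w∈ext
    with condI , weight≤n ← ∈-Y⁻ n x∈Y
    with b≡0 , a≡ ← ∈-wordsWithTwos⁻ M (n ∸ weight x) y∈ =
    CondI⇒noOneOneThree x y condI b≡0 ,
    trans (weight-++-noThree x y b≡0) (trans (cong (weight x +_) a≡) (m+[n∸m]≡n weight≤n))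

  ∈-admissibleWords⁺ : ∀ {w} → NoOneOneThree w → (∀ j → digitAt w j ≡ three → j < 2 * n ∸ 1) →
                       weight w ≡ n → w ∈ admissibleWords n M
  ∈-admissibleWords⁺ {w} noOneOneThree threes<t weight≡n with x , y , refl ← splitAt (2 * n ∸ 1) w =
    ∈-concatMap⁺ extensions (lose x∈Y (∈-map⁺ (x ++ᵛ_) y∈))
    where
    b≡0 : b y ≡ 0
    b≡0 = ≢three⇒b≡0 y λ j ≡three → m+n≮m _ j (threes<t _ (trans (digitAt-++ʳ x y j) ≡three))
    weight≡ : weight x + a y ≡ n
    weight≡ = trans (sym (weight-++-noThree x y b≡0)) weight≡n
    x∈Y : x ∈ Y n
    x∈Y = ∈-Y⁺ n (noOneOneThree⇒CondI x y noOneOneThree ,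
                  subst (weight x ≤_) weight≡ (m≤m+n (weight x) (a y)))
    y∈ : y ∈ wordsWithTwos M (n ∸ weight x)
    y∈ = ∈-wordsWithTwos⁺ y _ b≡0 (trans (sym (m+n∸m≡n (weight x) (a y))) (cong (_∸ weight x) weight≡))

  admissibleWords-unique : Unique (admissibleWords n M)
  admissibleWords-unique = Unique-concatMap extensions (Y-unique n)
    (λ x → Unique.map⁺ (Vec.++-injectiveʳ x x) (wordsWithTwos-unique M (n ∸ weight x)))
    disjoint
    where
    disjoint : ∀ {x x′ w} → w ∈ extensions x → w ∈ extensions x′ → x ≡ x′
    disjoint {x} {x′} w∈ w∈′
      with _ , _ , refl ← ∈-map⁻ (x ++ᵛ_) w∈ | _ , _ , eq ← ∈-map⁻ (x′ ++ᵛ_) w∈′ =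
      Vec.++-injectiveˡ x x′ eq

  length-admissibleWords : length (admissibleWords n M) ≡ sum (map (λ x → M C (n ∸ weight x)) (Y n))
  length-admissibleWords = trans (length-concatMap extensions (Y n))
    (cong sum (map-cong length-extensions (Y n)))
    where
    length-extensions : ∀ x → length (extensions x) ≡ M C (n ∸ weight x)
    length-extensions x =
      trans (length-map (x ++ᵛ_) (wordsWithTwos M (n ∸ weight x))) (length-wordsWithTwos M (n ∸ weight x))

semigroupCount : (n M : ℕ) → let L = 2 * n ∸ 1 + M in
  HasCardinality (List ℕ) (InSgWithMult (L + n) (suc L)) (sum (map (λ x → M C (n ∸ weight x)) (Y n)))
semigroupCount n M = subst (HasCardinality _ _) (length-admissibleWords n M)
  (HasCardinality-map gaps gaps-injective (admissibleWords n M) (admissibleWords-unique n M) sound complete)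
  where
  L : ℕ
  L = 2 * n ∸ 1 + M
  open Gaps L
  sound : ∀ {w} → w ∈ admissibleWords n M → InSgWithMult (L + n) m (gaps w)
  sound {w} w∈ with noOneOneThree , weight≡n ← ∈-admissibleWords⁻ n M w∈ =
    subst (λ k → InSgWithMult (L + k) m (gaps w)) weight≡n (gaps-semigroup w noOneOneThree)
  complete : ∀ {G} → InSgWithMult (L + n) m G → ∃[ w ] w ∈ admissibleWords n M × G ≡ gaps w
  complete {G} G-semigroup = decode G ,
    ∈-admissibleWords⁺ n M decode-noOneOneThree decode-threesBelow weight-decode ,
    G≡gaps-decode
    where open Decoding {n = n} (m≤m+n (2 * n ∸ 1) M) G-semigroup

genus-split : ∀ n g → 3 * suc n ≤ g + 1 → (2 * suc n ∸ 1 + (g + 1 ∸ 3 * suc n)) + suc n ≡ g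
genus-split n g 3k1≤g+1 = +-cancelʳ-≡ 1 _ _ (trans (regroup n (g + 1 ∸ 3 * suc n)) (m+[n∸m]≡n 3k1≤g+1))
  where
  -- n + suc (n + 0) is what 2 * suc n ∸ 1 computes to.
  regroup : ∀ n M → (n + suc (n + 0) + M) + suc n + 1 ≡ 3 * suc n + M
  regroup = solve-∀

genus≡⇒multiplicity≡ : ∀ {L k g} → L + k ≡ g → suc L ≡ g + 1 ∸ k
genus≡⇒multiplicity≡ {L} {k} refl = sym (trans (cong (_∸ k) (shift L k)) (m+n∸m≡n k (suc L)))
  where
  shift : ∀ L k → L + k + 1 ≡ k + suc L
  shift = solve-∀

theorem8p9 : (k1 g : ℕ) → 4 * k1 ≤ g + 1 →
    HasCardinality (List ℕ) (InSgWithMult g (g + 1 ∸ k1)) (rhs k1 g)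
-- 𝒴(−1) holds only the empty tuple, so both counts compute to a binomial coefficient C(_, 0) = 1.
theorem8p9 zero g _ = subst₂ (λ γ μ → HasCardinality (List ℕ) (InSgWithMult γ μ) (rhs 0 g))
  (+-identityʳ g) (+-comm 1 g) (semigroupCount 0 g)
theorem8p9 (suc n) g 4k1≤g+1 = subst₂ (λ γ μ → HasCardinality (List ℕ) (InSgWithMult γ μ) (rhs (suc n) g))
  genus≡ (genus≡⇒multiplicity≡ genus≡) (semigroupCount (suc n) (g + 1 ∸ 3 * suc n))
  where
  genus≡ : (2 * suc n ∸ 1 + (g + 1 ∸ 3 * suc n)) + suc n ≡ g
  genus≡ = genus-split n g (≤-trans (m≤n+m (3 * suc n) (suc n)) 4k1≤g+1)
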